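{- Suppose $\Gamma$ is an $(e,f)$-lift graph of type I. Then $2\Gamma$ is an $(e+1,f)$-lift graph of type I.
   Context: A graph means an undirected simple graph; $2\Gamma$ denotes the disjoint union of two copies of $\Gamma$. $A(\Gamma)$ is the adjacency matrix, $\operatorname{Char}_{A}(x)=\det(xI-A)$, $\mathsf c_k(p)$ is the coefficient of $x^{\deg p-k}$ in a polynomial $p$, and $\mathbf 1$ is the all-ones vector. For positive integers $e,f$, a graph $\Gamma$ is an $(e,f)$-lift graph of type I if (a) $2^{e-2}$ divides $\mathbf 1^\top A(\Gamma)^k\mathbf 1$ for every integer $k\geqslant 0$, and (b) for each $k\in\{1,\dots,e-1\}$, $\mathsf c_k(\operatorname{Char}_{A(\Gamma)})\equiv 0 \pmod{2^{e-k}}$ if $k\neq f$, and $\mathsf c_f(\operatorname{Char}_{A(\Gamma)})\equiv 2^{e-f-1}\pmod{2^{e-f}}$. -}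

module Defs where

open import Data.Bool using (Bool; true; false; if_then_else_)
open import Data.Nat as ℕ using (ℕ; zero; suc; _∸_; _<_; _≤ᵇ_)
open import Data.Nat.Divisibility as ℕD using ()
open import Data.Integer as ℤ using (ℤ; +_; -_)
open import Data.Integer.Divisibility as ℤD using ()
open import Data.Fin using (Fin; zero; suc; toℕ; punchIn; splitAt)
open import Data.Sum using (_⊎_; inj₁; inj₂)
open import Data.List using (List; []; _∷_; map; length; reverse)
open import Data.Product using (_×_)
open import Relation.Binary.PropositionalEquality using (_≡_; _≢_; refl)
open import Relation.Nullary using (¬_)

record Graph : Set where
  field
    n     : ℕ
    adj   : Fin n → Fin n → Bool
    sym   : ∀ i j → adj i j ≡ adj j i
    irr   : ∀ i → adj i i ≡ false
open Graph public

-- disjoint union of two copies: vertices Fin (n + n), split via splitAt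
adj2 : ∀ n → (Fin n → Fin n → Bool) → Fin (n ℕ.+ n) → Fin (n ℕ.+ n) → Bool
adj2 n a i j with splitAt n i | splitAt n j
... | inj₁ x | inj₁ y = a x y
... | inj₂ x | inj₂ y = a x y
... | inj₁ _ | inj₂ _ = false
... | inj₂ _ | inj₁ _ = false

adj2-sym : ∀ n (a : Fin n → Fin n → Bool) → (∀ i j → a i j ≡ a j i) →
           ∀ i j → adj2 n a i j ≡ adj2 n a j i
adj2-sym n a s i j with splitAt n i | splitAt n j
... | inj₁ x | inj₁ y = s x y
... | inj₂ x | inj₂ y = s x y
... | inj₁ _ | inj₂ _ = refl
... | inj₂ _ | inj₁ _ = refl

adj2-irr : ∀ n (a : Fin n → Fin n → Bool) → (∀ i → a i i ≡ false) →
           ∀ i → adj2 n a i i ≡ false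
adj2-irr n a r i with splitAt n i
... | inj₁ x = r x
... | inj₂ x = r x

double : Graph → Graph
double G = record
  { n   = n G ℕ.+ n G
  ; adj = adj2 (n G) (adj G)
  ; sym = adj2-sym (n G) (adj G) (sym G)
  ; irr = adj2-irr (n G) (adj G) (irr G)
  }

Mat : Set → ℕ → Set
Mat A m = Fin m → Fin m → A

b2n : Bool → ℕ
b2n true  = 1
b2n false = 0

sumℕ : ∀ m → (Fin m → ℕ) → ℕ
sumℕ zero    f = 0
sumℕ (suc m) f = f zero ℕ.+ sumℕ m (λ i → f (suc i))

matMulℕ : ∀ {m} → Mat ℕ m → Mat ℕ m → Mat ℕ m
matMulℕ {m} P Q i j = sumℕ m (λ l → P i l ℕ.* Q l j)

idMatℕ : ∀ {m} → Mat ℕ m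
idMatℕ i j with toℕ i ℕ.≟ toℕ j
... | Relation.Nullary.yes _ = 1
... | Relation.Nullary.no  _ = 0

matPowℕ : ∀ {m} → Mat ℕ m → ℕ → Mat ℕ m
matPowℕ P zero    = idMatℕ
matPowℕ P (suc k) = matMulℕ P (matPowℕ P k)

Aℕ : (G : Graph) → Mat ℕ (n G)
Aℕ G i j = b2n (adj G i j)

walkSum : Graph → ℕ → ℕ
walkSum G k = sumℕ (n G) (λ i → sumℕ (n G) (λ j → matPowℕ (Aℕ G) k i j))

-- Integer polynomials as coefficient lists (constant term first)

Poly : Set
Poly = List ℤ

_+ₚ_ : Poly → Poly → Poly
[]      +ₚ q       = q
(a ∷ p) +ₚ []      = a ∷ p
(a ∷ p) +ₚ (b ∷ q) = (a ℤ.+ b) ∷ (p +ₚ q)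

_*ₚ_ : Poly → Poly → Poly
[]      *ₚ q = []
(a ∷ p) *ₚ q = map (a ℤ.*_) q +ₚ (+ 0 ∷ (p *ₚ q))

negₚ : Poly → Poly
negₚ = map (-_)

constₚ : ℤ → Poly
constₚ c = c ∷ []

Xₚ : Poly
Xₚ = + 0 ∷ + 1 ∷ []

coeff : Poly → ℕ → ℤ
coeff []      _       = + 0
coeff (a ∷ p) zero    = a
coeff (a ∷ p) (suc i) = coeff p i

-- remove leading zero coefficients (i.e. trailing entries of the list)
dropZeros : List ℤ → List ℤ
dropZeros []          = []
dropZeros (+ 0 ∷ xs)  = dropZeros xs
dropZeros (x ∷ xs)    = x ∷ xs

-- degree (the zero polynomial gets degree 0 by convention)
degree : Poly → ℕ
degree p = length (dropZeros (reverse p)) ∸ 1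

cₖ : ℕ → Poly → ℤ
cₖ k p = if k ≤ᵇ degree p then coeff p (degree p ∸ k) else + 0

sumₚ : ∀ m → (Fin m → Poly) → Poly
sumₚ zero    f = []
sumₚ (suc m) f = f zero +ₚ sumₚ m (λ i → f (suc i))

signₚ : ℕ → Poly → Poly
signₚ zero          p = p
signₚ (suc zero)    p = negₚ p
signₚ (suc (suc k)) p = signₚ k p

detₚ : ∀ m → Mat Poly m → Poly
detₚ zero    M = constₚ (+ 1)
detₚ (suc m) M =
  sumₚ (suc m) (λ j → signₚ (toℕ j)
    (M zero j *ₚ detₚ m (λ r c → M (suc r) (punchIn j c))))

b2z : Bool → ℤ
b2z true  = + 1
b2z false = + 0

charPoly : Graph → Poly
charPoly G = detₚ (n G) (λ i j →
  (if isEq i j then Xₚ else []) +ₚ negₚ (constₚ (b2z (adj G i j))))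
  where
  isEq : Fin (n G) → Fin (n G) → Bool
  isEq i j = toℕ i ℕ.≡ᵇ toℕ j

_≡_[mod_] : ℤ → ℤ → ℤ → Set
a ≡ b [mod m ] = m ℤD.∣ (a ℤ.- b)

pow2 : ℕ → ℤ
pow2 k = + (2 ℕ.^ k)

record LiftTypeI (e f : ℕ) (G : Graph) : Set where
  field
    e-pos  : 0 < e
    f-pos  : 0 < f
    f<e    : f < e
    walks  : ∀ k → (2 ℕ.^ (e ∸ 2)) ℕD.∣ walkSum G k
    coeffs : ∀ k → 1 ℕ.≤ k → k < e → k ≢ f →
               cₖ k (charPoly G) ≡ + 0 [mod pow2 (e ∸ k) ]
    coeffF : cₖ f (charPoly G) ≡ pow2 (e ∸ f ∸ 1) [mod pow2 (e ∸ f) ]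

{-# OPTIONS --safe #-}
module Submission where

-- Since 2Γ is a disjoint union, A(2Γ) and xI − A(2Γ) are block diagonal with two copies of
-- A(Γ) and xI − A(Γ). Hence 1ᵀA(2Γ)ᵏ1 = 2·1ᵀA(Γ)ᵏ1 and Char_{A(2Γ)} = P² for P = Char_{A(Γ)}.
-- Writing c_a = c_a(P), we have c_0 = 1 and c_1 = −tr A(Γ) = 0, so
--   c_k(P²) = Σ_{a+b=k} c_a c_b = 2c_k + Σ_{a,b≥2, a+b=k} c_a c_b.
-- The hypotheses give 2^(e−a−1) | c_a for 0 < a < e, and since b ≥ 2 this alone makes each
-- cross term divisible by 2^(e+1−k). Doubling c_k turns c_k ≡ 0 (mod 2^(e−k)) and
-- c_f ≡ 2^(e−f−1) (mod 2^(e−f)) into the required congruences modulo 2^(e+1−k).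

open import Defs
open import Data.Nat using (ℕ; suc)

open import Data.Nat as ℕ using (zero; _∸_; _≤_; _<_; z≤n; s≤s; _≤ᵇ_)
import Data.Nat.Properties as ℕₚ
import Data.Nat.Divisibility as ℕᵈ
open import Data.Integer using (ℤ; +_; -_; -[1+_]; _+_; _*_; _-_; -1ℤ)
import Data.Integer.Properties as ℤₚ
open import Data.Integer.Tactic.RingSolver using (solve-∀)
open import Data.Integer.Divisibility.Signed
  using (_∣_; divides; ∣ᵤ⇒∣; ∣⇒∣ᵤ; ∣-refl; ∣-trans; ∣m∣n⇒∣m+n; ∣m+n∣n⇒∣m; ∣m⇒∣-m; ∣m⇒∣m*n)
open import Data.Product using (_,_)
open import Data.List using ([]; _∷_; map; length; reverse; _++_)
import Data.List.Properties as Listₚ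
open import Data.Fin as Fin using (Fin; zero; suc; toℕ; punchIn; _↑ˡ_; _↑ʳ_)
open import Data.Fin.Properties
  using (toℕ-↑ˡ; toℕ-↑ʳ; toℕ<n; toℕ-injective; splitAt-↑ˡ; splitAt-↑ʳ; punchInᵢ≢i; suc-injective)
open import Data.Bool using (Bool; true; false; if_then_else_)
open import Data.Sum using (_⊎_; inj₁; inj₂)
open import Function using (_∘_)
open import Relation.Nullary using (yes; no; contradiction)
open import Level using (0ℓ)
open import Relation.Binary.Bundles using (Setoid)
import Relation.Binary.Reasoning.Setoid as SetoidReasoning
open import Relation.Binary.PropositionalEquality
  using (_≡_; _≢_; refl; trans; cong; cong₂; subst; module ≡-Reasoning) renaming (sym to ≡-sym)

-- Polynomials up to coefficientwise equality

infix 4 _≈ₚ_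
record _≈ₚ_ (p q : Poly) : Set where
  constructor coeffwise
  field coeff-≡ : ∀ i → coeff p i ≡ coeff q i
open _≈ₚ_

≈ₚ-refl : ∀ {p} → p ≈ₚ p
≈ₚ-refl = coeffwise λ _ → refl

≈ₚ-sym : ∀ {p q} → p ≈ₚ q → q ≈ₚ p
≈ₚ-sym p≈q = coeffwise λ i → ≡-sym (coeff-≡ p≈q i)

≈ₚ-trans : ∀ {p q r} → p ≈ₚ q → q ≈ₚ r → p ≈ₚ r
≈ₚ-trans p≈q q≈r = coeffwise λ i → trans (coeff-≡ p≈q i) (coeff-≡ q≈r i)

≈ₚ-setoid : Setoid 0ℓ 0ℓ
≈ₚ-setoid = record
  { Carrier = Poly
  ; _≈_ = _≈ₚ_
  ; isEquivalence = record { refl = ≈ₚ-refl ; sym = ≈ₚ-sym ; trans = ≈ₚ-trans }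
  }

module ≈ₚ-Reasoning = SetoidReasoning ≈ₚ-setoid

-- (a ∷ p) *ₚ q unfolds to a ·ₚ q +ₚ (+ 0 ∷ p *ₚ q).
infixr 25 _·ₚ_
_·ₚ_ : ℤ → Poly → Poly
a ·ₚ q = map (a *_) q

coeff-+ₚ : ∀ p q i → coeff (p +ₚ q) i ≡ coeff p i + coeff q i
coeff-+ₚ []      q       i       = ≡-sym (ℤₚ.+-identityˡ _)
coeff-+ₚ (a ∷ p) []      i       = ≡-sym (ℤₚ.+-identityʳ _)
coeff-+ₚ (a ∷ p) (b ∷ q) zero    = refl
coeff-+ₚ (a ∷ p) (b ∷ q) (suc i) = coeff-+ₚ p q i

coeff-·ₚ : ∀ a q i → coeff (a ·ₚ q) i ≡ a * coeff q i
coeff-·ₚ a []      i       = ≡-sym (ℤₚ.*-zeroʳ a)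
coeff-·ₚ a (b ∷ q) zero    = refl
coeff-·ₚ a (b ∷ q) (suc i) = coeff-·ₚ a q i

coeff-negₚ : ∀ p i → coeff (negₚ p) i ≡ - coeff p i
coeff-negₚ []      i       = refl
coeff-negₚ (a ∷ p) zero    = refl
coeff-negₚ (a ∷ p) (suc i) = coeff-negₚ p i

∷-cong : ∀ {a b p q} → a ≡ b → p ≈ₚ q → (a ∷ p) ≈ₚ (b ∷ q)
∷-cong a≡b p≈q = coeffwise λ { zero → a≡b ; (suc i) → coeff-≡ p≈q i }

+ₚ-cong : ∀ {p p′ q q′} → p ≈ₚ p′ → q ≈ₚ q′ → p +ₚ q ≈ₚ p′ +ₚ q′
+ₚ-cong {p} {p′} {q} {q′} p≈p′ q≈q′ = coeffwise λ i → begin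
  coeff (p +ₚ q) i          ≡⟨ coeff-+ₚ p q i ⟩
  coeff p i + coeff q i     ≡⟨ cong₂ _+_ (coeff-≡ p≈p′ i) (coeff-≡ q≈q′ i) ⟩
  coeff p′ i + coeff q′ i   ≡⟨ coeff-+ₚ p′ q′ i ⟨
  coeff (p′ +ₚ q′) i        ∎
  where open ≡-Reasoning

≈ₚ-reflexive : ∀ {p q} → p ≡ q → p ≈ₚ q
≈ₚ-reflexive refl = ≈ₚ-refl

0∷-≈[] : ∀ {s} → s ≈ₚ [] → (+ 0 ∷ s) ≈ₚ []
0∷-≈[] s≈[] = coeffwise λ { zero → refl ; (suc i) → coeff-≡ s≈[] i }

+ₚ-identityʳ : ∀ p → p +ₚ [] ≈ₚ p
+ₚ-identityʳ []      = ≈ₚ-refl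
+ₚ-identityʳ (a ∷ p) = ≈ₚ-refl

+ₚ-assoc : ∀ p q r → (p +ₚ q) +ₚ r ≈ₚ p +ₚ (q +ₚ r)
+ₚ-assoc p q r = coeffwise λ i → begin
  coeff ((p +ₚ q) +ₚ r) i
    ≡⟨ trans (coeff-+ₚ (p +ₚ q) r i) (cong (_+ coeff r i) (coeff-+ₚ p q i)) ⟩
  (coeff p i + coeff q i) + coeff r i
    ≡⟨ ℤₚ.+-assoc (coeff p i) (coeff q i) (coeff r i) ⟩
  coeff p i + (coeff q i + coeff r i)
    ≡⟨ trans (coeff-+ₚ p (q +ₚ r) i) (cong (_+_ (coeff p i)) (coeff-+ₚ q r i)) ⟨
  coeff (p +ₚ (q +ₚ r)) i
    ∎
  where open ≡-Reasoning

+ₚ-interchange : ∀ p q r s → (p +ₚ q) +ₚ (r +ₚ s) ≈ₚ (p +ₚ r) +ₚ (q +ₚ s)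
+ₚ-interchange p q r s = coeffwise λ i → begin
  coeff ((p +ₚ q) +ₚ (r +ₚ s)) i
    ≡⟨ trans (coeff-+ₚ (p +ₚ q) (r +ₚ s) i) (cong₂ _+_ (coeff-+ₚ p q i) (coeff-+ₚ r s i)) ⟩
  (coeff p i + coeff q i) + (coeff r i + coeff s i)
    ≡⟨ interchange (coeff p i) (coeff q i) (coeff r i) (coeff s i) ⟩
  (coeff p i + coeff r i) + (coeff q i + coeff s i)
    ≡⟨ trans (coeff-+ₚ (p +ₚ r) (q +ₚ s) i) (cong₂ _+_ (coeff-+ₚ p r i) (coeff-+ₚ q s i)) ⟨
  coeff ((p +ₚ r) +ₚ (q +ₚ s)) i
    ∎
  where
  open ≡-Reasoning
  interchange : ∀ a b c d → (a + b) + (c + d) ≡ (a + c) + (b + d)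
  interchange = solve-∀

·ₚ-congʳ : ∀ a {q q′} → q ≈ₚ q′ → a ·ₚ q ≈ₚ a ·ₚ q′
·ₚ-congʳ a {q} {q′} q≈q′ = coeffwise λ i →
  trans (coeff-·ₚ a q i) (trans (cong (a *_) (coeff-≡ q≈q′ i)) (≡-sym (coeff-·ₚ a q′ i)))

·ₚ-zeroˡ : ∀ q → (+ 0) ·ₚ q ≈ₚ []
·ₚ-zeroˡ q = coeffwise λ i → trans (coeff-·ₚ (+ 0) q i) (ℤₚ.*-zeroˡ (coeff q i))

·ₚ-identityˡ : ∀ q → (+ 1) ·ₚ q ≈ₚ q
·ₚ-identityˡ q = coeffwise λ i → trans (coeff-·ₚ (+ 1) q i) (ℤₚ.*-identityˡ (coeff q i))

·ₚ-distribʳ : ∀ a b r → (a + b) ·ₚ r ≈ₚ a ·ₚ r +ₚ b ·ₚ r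
·ₚ-distribʳ a b r = coeffwise λ i → begin
  coeff ((a + b) ·ₚ r) i                     ≡⟨ coeff-·ₚ (a + b) r i ⟩
  (a + b) * coeff r i                        ≡⟨ ℤₚ.*-distribʳ-+ (coeff r i) a b ⟩
  a * coeff r i + b * coeff r i              ≡⟨ cong₂ _+_ (coeff-·ₚ a r i) (coeff-·ₚ b r i) ⟨
  coeff (a ·ₚ r) i + coeff (b ·ₚ r) i        ≡⟨ coeff-+ₚ (a ·ₚ r) (b ·ₚ r) i ⟨
  coeff (a ·ₚ r +ₚ b ·ₚ r) i                 ∎
  where open ≡-Reasoning

·ₚ-distribˡ : ∀ a p q → a ·ₚ (p +ₚ q) ≈ₚ a ·ₚ p +ₚ a ·ₚ q
·ₚ-distribˡ a p q = coeffwise λ i → begin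
  coeff (a ·ₚ (p +ₚ q)) i                    ≡⟨ trans (coeff-·ₚ a (p +ₚ q) i) (cong (a *_) (coeff-+ₚ p q i)) ⟩
  a * (coeff p i + coeff q i)                ≡⟨ ℤₚ.*-distribˡ-+ a (coeff p i) (coeff q i) ⟩
  a * coeff p i + a * coeff q i              ≡⟨ cong₂ _+_ (coeff-·ₚ a p i) (coeff-·ₚ a q i) ⟨
  coeff (a ·ₚ p) i + coeff (a ·ₚ q) i        ≡⟨ coeff-+ₚ (a ·ₚ p) (a ·ₚ q) i ⟨
  coeff (a ·ₚ p +ₚ a ·ₚ q) i                 ∎
  where open ≡-Reasoning

·ₚ-assoc : ∀ a b r → (a * b) ·ₚ r ≈ₚ a ·ₚ (b ·ₚ r)
·ₚ-assoc a b r = coeffwise λ i → begin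
  coeff ((a * b) ·ₚ r) i      ≡⟨ coeff-·ₚ (a * b) r i ⟩
  (a * b) * coeff r i         ≡⟨ ℤₚ.*-assoc a b (coeff r i) ⟩
  a * (b * coeff r i)         ≡⟨ trans (coeff-·ₚ a (b ·ₚ r) i) (cong (a *_) (coeff-·ₚ b r i)) ⟨
  coeff (a ·ₚ (b ·ₚ r)) i     ∎
  where open ≡-Reasoning

·ₚ-0∷ : ∀ a s → a ·ₚ (+ 0 ∷ s) ≈ₚ + 0 ∷ a ·ₚ s
·ₚ-0∷ a s = ∷-cong (ℤₚ.*-zeroʳ a) ≈ₚ-refl

negₚ≈-1·ₚ : ∀ p → negₚ p ≈ₚ -1ℤ ·ₚ p
negₚ≈-1·ₚ p = coeffwise λ i →
  trans (coeff-negₚ p i) (trans (≡-sym (ℤₚ.-1*i≡-i (coeff p i))) (≡-sym (coeff-·ₚ -1ℤ p i)))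

negₚ-cong : ∀ {p q} → p ≈ₚ q → negₚ p ≈ₚ negₚ q
negₚ-cong {p} {q} p≈q =
  ≈ₚ-trans (negₚ≈-1·ₚ p) (≈ₚ-trans (·ₚ-congʳ -1ℤ p≈q) (≈ₚ-sym (negₚ≈-1·ₚ q)))

*ₚ-zeroˡ : ∀ {p} q → p ≈ₚ [] → p *ₚ q ≈ₚ []
*ₚ-zeroˡ {[]}    q _      = ≈ₚ-refl
*ₚ-zeroˡ {a ∷ p} q a∷p≈[] = +ₚ-cong a·q≈[] (0∷-≈[] (*ₚ-zeroˡ {p} q p≈[]))
  where
  p≈[] : p ≈ₚ []
  p≈[] = coeffwise λ i → coeff-≡ a∷p≈[] (suc i)
  a·q≈[] : a ·ₚ q ≈ₚ []
  a·q≈[] = ≈ₚ-trans (≈ₚ-reflexive (cong (_·ₚ q) (coeff-≡ a∷p≈[] 0))) (·ₚ-zeroˡ q)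

*ₚ-congˡ : ∀ {p p′} q → p ≈ₚ p′ → p *ₚ q ≈ₚ p′ *ₚ q
*ₚ-congˡ {[]}    {p′}     q p≈p′ = ≈ₚ-sym (*ₚ-zeroˡ q (≈ₚ-sym p≈p′))
*ₚ-congˡ {a ∷ p} {[]}     q p≈p′ = *ₚ-zeroˡ q p≈p′
*ₚ-congˡ {a ∷ p} {b ∷ p′} q p≈p′ =
  +ₚ-cong (≈ₚ-reflexive (cong (_·ₚ q) (coeff-≡ p≈p′ 0)))
          (∷-cong refl (*ₚ-congˡ {p} {p′} q (coeffwise λ i → coeff-≡ p≈p′ (suc i))))

*ₚ-congʳ : ∀ p {q q′} → q ≈ₚ q′ → p *ₚ q ≈ₚ p *ₚ q′
*ₚ-congʳ []      q≈q′ = ≈ₚ-refl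
*ₚ-congʳ (a ∷ p) q≈q′ = +ₚ-cong (·ₚ-congʳ a q≈q′) (∷-cong refl (*ₚ-congʳ p q≈q′))

*ₚ-cong : ∀ {p p′ q q′} → p ≈ₚ p′ → q ≈ₚ q′ → p *ₚ q ≈ₚ p′ *ₚ q′
*ₚ-cong {p′ = p′} {q = q} p≈p′ q≈q′ = ≈ₚ-trans (*ₚ-congˡ q p≈p′) (*ₚ-congʳ p′ q≈q′)

0∷-*ₚ : ∀ s r → (+ 0 ∷ s) *ₚ r ≈ₚ + 0 ∷ s *ₚ r
0∷-*ₚ s r = +ₚ-cong (·ₚ-zeroˡ r) ≈ₚ-refl

*ₚ-distribʳ : ∀ p q r → (p +ₚ q) *ₚ r ≈ₚ (p *ₚ r) +ₚ (q *ₚ r)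
*ₚ-distribʳ []      q       r = ≈ₚ-refl
*ₚ-distribʳ (a ∷ p) []      r = ≈ₚ-sym (+ₚ-identityʳ _)
*ₚ-distribʳ (a ∷ p) (b ∷ q) r = begin
  (a + b) ·ₚ r +ₚ (+ 0 ∷ (p +ₚ q) *ₚ r)
    ≈⟨ +ₚ-cong (·ₚ-distribʳ a b r) (∷-cong refl (*ₚ-distribʳ p q r)) ⟩
  (a ·ₚ r +ₚ b ·ₚ r) +ₚ ((+ 0 ∷ p *ₚ r) +ₚ (+ 0 ∷ q *ₚ r))
    ≈⟨ +ₚ-interchange (a ·ₚ r) (b ·ₚ r) _ _ ⟩
  (a ·ₚ r +ₚ (+ 0 ∷ p *ₚ r)) +ₚ (b ·ₚ r +ₚ (+ 0 ∷ q *ₚ r))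
    ∎
  where open ≈ₚ-Reasoning

·ₚ-*ₚ : ∀ a p r → (a ·ₚ p) *ₚ r ≈ₚ a ·ₚ (p *ₚ r)
·ₚ-*ₚ a []      r = ≈ₚ-refl
·ₚ-*ₚ a (b ∷ p) r = begin
  (a * b) ·ₚ r +ₚ (+ 0 ∷ (a ·ₚ p) *ₚ r)   ≈⟨ +ₚ-cong (·ₚ-assoc a b r) (∷-cong refl (·ₚ-*ₚ a p r)) ⟩
  a ·ₚ (b ·ₚ r) +ₚ (+ 0 ∷ a ·ₚ (p *ₚ r))  ≈⟨ +ₚ-cong ≈ₚ-refl (·ₚ-0∷ a (p *ₚ r)) ⟨
  a ·ₚ (b ·ₚ r) +ₚ a ·ₚ (+ 0 ∷ p *ₚ r)    ≈⟨ ·ₚ-distribˡ a (b ·ₚ r) _ ⟨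
  a ·ₚ (b ·ₚ r +ₚ (+ 0 ∷ p *ₚ r))         ∎
  where open ≈ₚ-Reasoning

*ₚ-assoc : ∀ p q r → (p *ₚ q) *ₚ r ≈ₚ p *ₚ (q *ₚ r)
*ₚ-assoc []      q r = ≈ₚ-refl
*ₚ-assoc (a ∷ p) q r = begin
  (a ·ₚ q +ₚ (+ 0 ∷ p *ₚ q)) *ₚ r           ≈⟨ *ₚ-distribʳ (a ·ₚ q) _ r ⟩
  ((a ·ₚ q) *ₚ r) +ₚ ((+ 0 ∷ p *ₚ q) *ₚ r)      ≈⟨ +ₚ-cong (·ₚ-*ₚ a q r) (0∷-*ₚ (p *ₚ q) r) ⟩
  a ·ₚ (q *ₚ r) +ₚ (+ 0 ∷ (p *ₚ q) *ₚ r)    ≈⟨ +ₚ-cong ≈ₚ-refl (∷-cong refl (*ₚ-assoc p q r)) ⟩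
  a ·ₚ (q *ₚ r) +ₚ (+ 0 ∷ p *ₚ (q *ₚ r))    ∎
  where open ≈ₚ-Reasoning

negₚ-*ₚ : ∀ p r → negₚ p *ₚ r ≈ₚ negₚ (p *ₚ r)
negₚ-*ₚ p r = begin
  negₚ p *ₚ r          ≈⟨ *ₚ-congˡ r (negₚ≈-1·ₚ p) ⟩
  (-1ℤ ·ₚ p) *ₚ r      ≈⟨ ·ₚ-*ₚ -1ℤ p r ⟩
  -1ℤ ·ₚ (p *ₚ r)      ≈⟨ negₚ≈-1·ₚ (p *ₚ r) ⟨
  negₚ (p *ₚ r)        ∎
  where open ≈ₚ-Reasoning

*ₚ-identityˡ : ∀ q → constₚ (+ 1) *ₚ q ≈ₚ q
*ₚ-identityˡ q = ≈ₚ-trans (+ₚ-cong (·ₚ-identityˡ q) (0∷-≈[] ≈ₚ-refl)) (+ₚ-identityʳ q)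

-- Laplace expansion and block triangular determinants

signₚ-cong : ∀ k {p q} → p ≈ₚ q → signₚ k p ≈ₚ signₚ k q
signₚ-cong zero          p≈q = p≈q
signₚ-cong (suc zero)    p≈q = negₚ-cong p≈q
signₚ-cong (suc (suc k)) p≈q = signₚ-cong k p≈q

signₚ-*ₚ : ∀ k p r → signₚ k p *ₚ r ≈ₚ signₚ k (p *ₚ r)
signₚ-*ₚ zero          p r = ≈ₚ-refl
signₚ-*ₚ (suc zero)    p r = negₚ-*ₚ p r
signₚ-*ₚ (suc (suc k)) p r = signₚ-*ₚ k p r

signₚ-zero : ∀ k {p} → p ≈ₚ [] → signₚ k p ≈ₚ []
signₚ-zero zero          p≈[] = p≈[]
signₚ-zero (suc zero)    p≈[] = negₚ-cong p≈[]
signₚ-zero (suc (suc k)) p≈[] = signₚ-zero k p≈[]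

sumₚ-cong : ∀ m {f g : Fin m → Poly} → (∀ j → f j ≈ₚ g j) → sumₚ m f ≈ₚ sumₚ m g
sumₚ-cong zero    f≈g = ≈ₚ-refl
sumₚ-cong (suc m) f≈g = +ₚ-cong (f≈g zero) (sumₚ-cong m (λ j → f≈g (suc j)))

sumₚ-zero : ∀ m {f : Fin m → Poly} → (∀ j → f j ≈ₚ []) → sumₚ m f ≈ₚ []
sumₚ-zero zero    f≈[] = ≈ₚ-refl
sumₚ-zero (suc m) f≈[] = +ₚ-cong (f≈[] zero) (sumₚ-zero m (λ j → f≈[] (suc j)))

sumₚ-*ₚ : ∀ m (f : Fin m → Poly) r → sumₚ m f *ₚ r ≈ₚ sumₚ m (λ j → f j *ₚ r)
sumₚ-*ₚ zero    f r = ≈ₚ-refl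
sumₚ-*ₚ (suc m) f r =
  ≈ₚ-trans (*ₚ-distribʳ (f zero) _ r) (+ₚ-cong ≈ₚ-refl (sumₚ-*ₚ m (λ j → f (suc j)) r))

sumₚ-split : ∀ m k (f : Fin (m ℕ.+ k) → Poly) →
             sumₚ (m ℕ.+ k) f ≈ₚ sumₚ m (λ j → f (j ↑ˡ k)) +ₚ sumₚ k (λ j → f (m ↑ʳ j))
sumₚ-split zero    k f = ≈ₚ-refl
sumₚ-split (suc m) k f =
  ≈ₚ-trans (+ₚ-cong ≈ₚ-refl (sumₚ-split m k (λ j → f (suc j)))) (≈ₚ-sym (+ₚ-assoc (f zero) _ _))

minor : ∀ {m} → Mat Poly (suc m) → Fin (suc m) → Mat Poly m
minor M j r c = M (suc r) (punchIn j c)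

-- detₚ (suc m) M unfolds to sumₚ (suc m) (laplaceTerm M).
laplaceTerm : ∀ {m} → Mat Poly (suc m) → Fin (suc m) → Poly
laplaceTerm {m} M j = signₚ (toℕ j) (M zero j *ₚ detₚ m (minor M j))

detₚ-cong : ∀ m {M M′ : Mat Poly m} → (∀ i j → M i j ≈ₚ M′ i j) → detₚ m M ≈ₚ detₚ m M′
detₚ-cong zero    M≈M′ = ≈ₚ-refl
detₚ-cong (suc m) M≈M′ = sumₚ-cong (suc m) λ j →
  signₚ-cong (toℕ j) (*ₚ-cong (M≈M′ zero j) (detₚ-cong m (λ r c → M≈M′ (suc r) (punchIn j c))))

punchIn-↑ˡ : ∀ {m} k (j : Fin (suc m)) (c : Fin m) → punchIn (j ↑ˡ k) (c ↑ˡ k) ≡ punchIn j c ↑ˡ k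
punchIn-↑ˡ k zero    c       = refl
punchIn-↑ˡ k (suc j) zero    = refl
punchIn-↑ˡ k (suc j) (suc c) = cong suc (punchIn-↑ˡ k j c)

punchIn-↑ʳ : ∀ m {k} (j : Fin (suc m)) (c : Fin k) → punchIn (j ↑ˡ k) (m ↑ʳ c) ≡ suc m ↑ʳ c
punchIn-↑ʳ m       zero    c = refl
punchIn-↑ʳ (suc m) (suc j) c = cong suc (punchIn-↑ʳ m j c)

record BlockLowerTriangular {m k} (M : Mat Poly (m ℕ.+ k)) (A : Mat Poly m) (B : Mat Poly k) : Set where
  field
    upperLeft  : ∀ i j → M (i ↑ˡ k) (j ↑ˡ k) ≈ₚ A i j
    lowerRight : ∀ i j → M (m ↑ʳ i) (m ↑ʳ j) ≈ₚ B i j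
    upperRight : ∀ i j → M (i ↑ˡ k) (m ↑ʳ j) ≈ₚ []
open BlockLowerTriangular

minor-blockLowerTriangular :
  ∀ {m k} {M : Mat Poly (suc m ℕ.+ k)} {A : Mat Poly (suc m)} {B : Mat Poly k} →
  BlockLowerTriangular M A B → ∀ j → BlockLowerTriangular (minor M (j ↑ˡ k)) (minor A j) B
minor-blockLowerTriangular {m} {k} {M} {A} {B} T j = record
  { upperLeft  = λ r c → subst (λ z → M (suc (r ↑ˡ k)) z ≈ₚ A (suc r) (punchIn j c))
                               (≡-sym (punchIn-↑ˡ k j c)) (upperLeft T (suc r) (punchIn j c))
  ; lowerRight = λ r c → subst (λ z → M (suc (m ↑ʳ r)) z ≈ₚ B r c)
                               (≡-sym (punchIn-↑ʳ m j c)) (lowerRight T r c)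
  ; upperRight = λ r c → subst (λ z → M (suc (r ↑ˡ k)) z ≈ₚ [])
                               (≡-sym (punchIn-↑ʳ m j c)) (upperRight T (suc r) c)
  }

detₚ-blockLowerTriangular :
  ∀ m k {M : Mat Poly (m ℕ.+ k)} {A : Mat Poly m} {B : Mat Poly k} →
  BlockLowerTriangular M A B → detₚ (m ℕ.+ k) M ≈ₚ detₚ m A *ₚ detₚ k B
detₚ-blockLowerTriangular zero    k {B = B} T =
  ≈ₚ-trans (detₚ-cong k (lowerRight T)) (≈ₚ-sym (*ₚ-identityˡ (detₚ k B)))
detₚ-blockLowerTriangular (suc m) k {M} {A} {B} T = begin
  sumₚ (suc m ℕ.+ k) (laplaceTerm M)
    ≈⟨ sumₚ-split (suc m) k (laplaceTerm M) ⟩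
  sumₚ (suc m) (λ j → laplaceTerm M (j ↑ˡ k)) +ₚ sumₚ k (λ j → laplaceTerm M (suc m ↑ʳ j))
    ≈⟨ +ₚ-cong (sumₚ-cong (suc m) leftColumns) (sumₚ-zero k rightColumns) ⟩
  sumₚ (suc m) (λ j → laplaceTerm A j *ₚ detₚ k B) +ₚ []
    ≈⟨ +ₚ-identityʳ _ ⟩
  sumₚ (suc m) (λ j → laplaceTerm A j *ₚ detₚ k B)
    ≈⟨ sumₚ-*ₚ (suc m) (laplaceTerm A) (detₚ k B) ⟨
  sumₚ (suc m) (laplaceTerm A) *ₚ detₚ k B
    ∎
  where
  open ≈ₚ-Reasoning
  rightColumns : ∀ j → laplaceTerm M (suc m ↑ʳ j) ≈ₚ []
  rightColumns j = signₚ-zero (toℕ (suc m ↑ʳ j)) (*ₚ-zeroˡ _ (upperRight T zero j))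
  leftColumns : ∀ j → laplaceTerm M (j ↑ˡ k) ≈ₚ laplaceTerm A j *ₚ detₚ k B
  leftColumns j rewrite toℕ-↑ˡ j k = begin
    signₚ (toℕ j) (M zero (j ↑ˡ k) *ₚ detₚ (m ℕ.+ k) (minor M (j ↑ˡ k)))
      ≈⟨ signₚ-cong (toℕ j) (*ₚ-cong (upperLeft T zero j)
           (detₚ-blockLowerTriangular m k (minor-blockLowerTriangular T j))) ⟩
    signₚ (toℕ j) (A zero j *ₚ (detₚ m (minor A j) *ₚ detₚ k B))
      ≈⟨ signₚ-cong (toℕ j) (*ₚ-assoc (A zero j) _ _) ⟨
    signₚ (toℕ j) ((A zero j *ₚ detₚ m (minor A j)) *ₚ detₚ k B)
      ≈⟨ signₚ-*ₚ (toℕ j) _ _ ⟨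
    laplaceTerm A j *ₚ detₚ k B
      ∎

-- Degree bounds and top coefficients

record Deg≤ (p : Poly) (d : ℕ) : Set where
  constructor vanishingAbove
  field vanishes : ∀ i → d < i → coeff p i ≡ + 0
open Deg≤

Deg≤-cong : ∀ {p q d} → p ≈ₚ q → Deg≤ p d → Deg≤ q d
Deg≤-cong p≈q p≤d = vanishingAbove λ i d<i → trans (≡-sym (coeff-≡ p≈q i)) (vanishes p≤d i d<i)

Deg≤-mono : ∀ {p d d′} → d ≤ d′ → Deg≤ p d → Deg≤ p d′
Deg≤-mono d≤d′ p≤d = vanishingAbove λ i d′<i → vanishes p≤d i (ℕₚ.≤-<-trans d≤d′ d′<i)

Deg≤-[] : ∀ d → Deg≤ [] d
Deg≤-[] d = vanishingAbove λ _ _ → refl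

Deg≤-∷ : ∀ {a p d} → Deg≤ p d → Deg≤ (a ∷ p) (suc d)
Deg≤-∷ p≤d = vanishingAbove λ { (suc i) (s≤s d<i) → vanishes p≤d i d<i }

Deg≤-tail : ∀ {a p d} → Deg≤ (a ∷ p) (suc d) → Deg≤ p d
Deg≤-tail a∷p≤1+d = vanishingAbove λ i d<i → vanishes a∷p≤1+d (suc i) (s≤s d<i)

Deg≤0-tail : ∀ {a p} → Deg≤ (a ∷ p) 0 → p ≈ₚ []
Deg≤0-tail a∷p≤0 = coeffwise λ i → vanishes a∷p≤0 (suc i) (s≤s z≤n)

Deg≤-+ₚ : ∀ {p q d} → Deg≤ p d → Deg≤ q d → Deg≤ (p +ₚ q) d
Deg≤-+ₚ {p} {q} p≤d q≤d = vanishingAbove λ i d<i →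
  trans (coeff-+ₚ p q i) (cong₂ _+_ (vanishes p≤d i d<i) (vanishes q≤d i d<i))

Deg≤-·ₚ : ∀ a {q d} → Deg≤ q d → Deg≤ (a ·ₚ q) d
Deg≤-·ₚ a {q} q≤d = vanishingAbove λ i d<i →
  trans (coeff-·ₚ a q i) (trans (cong (a *_) (vanishes q≤d i d<i)) (ℤₚ.*-zeroʳ a))

Deg≤-signₚ : ∀ k {p d} → Deg≤ p d → Deg≤ (signₚ k p) d
Deg≤-signₚ zero          p≤d = p≤d
Deg≤-signₚ (suc zero)    p≤d = Deg≤-cong (≈ₚ-sym (negₚ≈-1·ₚ _)) (Deg≤-·ₚ -1ℤ p≤d)
Deg≤-signₚ (suc (suc k)) p≤d = Deg≤-signₚ k p≤d

Deg≤-sumₚ : ∀ m {f : Fin m → Poly} {d} → (∀ j → Deg≤ (f j) d) → Deg≤ (sumₚ m f) d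
Deg≤-sumₚ zero    f≤d = Deg≤-[] _
Deg≤-sumₚ (suc m) f≤d = Deg≤-+ₚ (f≤d zero) (Deg≤-sumₚ m (λ j → f≤d (suc j)))

Deg≤-*ₚ : ∀ {p q d₁ d₂} → Deg≤ p d₁ → Deg≤ q d₂ → Deg≤ (p *ₚ q) (d₁ ℕ.+ d₂)
Deg≤-*ₚ {[]}              _     _    = Deg≤-[] _
Deg≤-*ₚ {a ∷ p} {q} {zero}  a∷p≤0 q≤d₂ =
  Deg≤-+ₚ (Deg≤-·ₚ a q≤d₂) (Deg≤-cong (≈ₚ-sym (0∷-≈[] (*ₚ-zeroˡ q (Deg≤0-tail a∷p≤0)))) (Deg≤-[] _))
Deg≤-*ₚ {a ∷ p} {q} {suc d₁} {d₂} a∷p≤1+d₁ q≤d₂ =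
  Deg≤-+ₚ (Deg≤-·ₚ a (Deg≤-mono (ℕₚ.m≤n+m d₂ (suc d₁)) q≤d₂))
          (Deg≤-∷ (Deg≤-*ₚ (Deg≤-tail a∷p≤1+d₁) q≤d₂))

Deg≤-detₚ : ∀ m {M : Mat Poly m} (w : Fin m → ℕ) → (∀ i j → Deg≤ (M i j) (w i)) →
            Deg≤ (detₚ m M) (sumℕ m w)
Deg≤-detₚ zero    w M≤w = vanishingAbove λ { (suc i) _ → refl }
Deg≤-detₚ (suc m) w M≤w = Deg≤-sumₚ (suc m) λ j → Deg≤-signₚ (toℕ j)
  (Deg≤-*ₚ (M≤w zero j) (Deg≤-detₚ m (λ i → w (suc i)) (λ r c → M≤w (suc r) (punchIn j c))))

∑< : ℕ → (ℕ → ℤ) → ℤ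
∑< zero    f = + 0
∑< (suc m) f = f 0 + ∑< m (f ∘ suc)

∑<-cong : ∀ m {f g : ℕ → ℤ} → (∀ a → f a ≡ g a) → ∑< m f ≡ ∑< m g
∑<-cong zero    f≡g = refl
∑<-cong (suc m) f≡g = cong₂ _+_ (f≡g 0) (∑<-cong m (f≡g ∘ suc))

∑<-zero : ∀ m {f : ℕ → ℤ} → (∀ a → f a ≡ + 0) → ∑< m f ≡ + 0
∑<-zero zero    f≡0 = refl
∑<-zero (suc m) f≡0 = cong₂ _+_ (f≡0 0) (∑<-zero m (f≡0 ∘ suc))

∑<-+ : ∀ m (f g : ℕ → ℤ) → ∑< m (λ a → f a + g a) ≡ ∑< m f + ∑< m g
∑<-+ zero    f g = refl
∑<-+ (suc m) f g = trans (cong (_+_ (f 0 + g 0)) (∑<-+ m (f ∘ suc) (g ∘ suc)))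
                         (interchange (f 0) (g 0) (∑< m (f ∘ suc)) (∑< m (g ∘ suc)))
  where
  interchange : ∀ a b c d → (a + b) + (c + d) ≡ (a + c) + (b + d)
  interchange = solve-∀

∑<-last : ∀ m (f : ℕ → ℤ) → ∑< (suc m) f ≡ ∑< m f + f m
∑<-last zero    f = trans (ℤₚ.+-identityʳ (f 0)) (≡-sym (ℤₚ.+-identityˡ (f 0)))
∑<-last (suc m) f = trans (cong (_+_ (f 0)) (∑<-last m (f ∘ suc))) (≡-sym (ℤₚ.+-assoc (f 0) _ _))

infixl 7 _⋆_
_⋆_ : (ℕ → ℤ) → (ℕ → ℤ) → ℕ → ℤ
(u ⋆ v) k = ∑< (suc k) (λ a → u a * v (k ∸ a))

⋆-cong : ∀ {u u′ v v′ : ℕ → ℤ} → (∀ a → u a ≡ u′ a) → (∀ a → v a ≡ v′ a) →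
         ∀ k → (u ⋆ v) k ≡ (u′ ⋆ v′) k
⋆-cong u≡u′ v≡v′ k = ∑<-cong (suc k) λ a → cong₂ _*_ (u≡u′ a) (v≡v′ (k ∸ a))

⋆-distribʳ : ∀ u u′ v k → ((λ a → u a + u′ a) ⋆ v) k ≡ (u ⋆ v) k + (u′ ⋆ v) k
⋆-distribʳ u u′ v k = trans (∑<-cong (suc k) λ a → ℤₚ.*-distribʳ-+ (v (k ∸ a)) (u a) (u′ a))
                            (∑<-+ (suc k) (λ a → u a * v (k ∸ a)) (λ a → u′ a * v (k ∸ a)))

-- The coefficient of x^(d-k) (0 if k > d), i.e. cₖ k p when p has degree d.
topCoeff : Poly → ℕ → ℕ → ℤ
topCoeff p d       zero    = coeff p d
topCoeff p zero    (suc k) = + 0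
topCoeff p (suc d) (suc k) = topCoeff p d k

topCoeff-cong : ∀ {p q} → p ≈ₚ q → ∀ d k → topCoeff p d k ≡ topCoeff q d k
topCoeff-cong p≈q d       zero    = coeff-≡ p≈q d
topCoeff-cong p≈q zero    (suc k) = refl
topCoeff-cong p≈q (suc d) (suc k) = topCoeff-cong p≈q d k

topCoeff-[] : ∀ d k → topCoeff [] d k ≡ + 0
topCoeff-[] d       zero    = refl
topCoeff-[] zero    (suc k) = refl
topCoeff-[] (suc d) (suc k) = topCoeff-[] d k

topCoeff-+ₚ : ∀ p q d k → topCoeff (p +ₚ q) d k ≡ topCoeff p d k + topCoeff q d k
topCoeff-+ₚ p q d       zero    = coeff-+ₚ p q d
topCoeff-+ₚ p q zero    (suc k) = refl
topCoeff-+ₚ p q (suc d) (suc k) = topCoeff-+ₚ p q d k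

topCoeff-·ₚ : ∀ a q d k → topCoeff (a ·ₚ q) d k ≡ a * topCoeff q d k
topCoeff-·ₚ a q d       zero    = coeff-·ₚ a q d
topCoeff-·ₚ a q zero    (suc k) = ≡-sym (ℤₚ.*-zeroʳ a)
topCoeff-·ₚ a q (suc d) (suc k) = topCoeff-·ₚ a q d k

topCoeff-0∷ : ∀ s d k → topCoeff (+ 0 ∷ s) (suc d) k ≡ topCoeff s d k
topCoeff-0∷ s d       zero          = refl
topCoeff-0∷ s zero    (suc zero)    = refl
topCoeff-0∷ s zero    (suc (suc k)) = refl
topCoeff-0∷ s (suc d) (suc k)       = topCoeff-0∷ s d k

topCoeff-∷ : ∀ x p d k → topCoeff (x ∷ p) (suc d) k ≡ topCoeff (x ∷ []) (suc d) k + topCoeff p d k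
topCoeff-∷ x p d k = begin
  topCoeff (x ∷ p) (suc d) k
    ≡⟨ topCoeff-cong x∷p≈ (suc d) k ⟩
  topCoeff ((x ∷ []) +ₚ (+ 0 ∷ p)) (suc d) k
    ≡⟨ topCoeff-+ₚ (x ∷ []) _ (suc d) k ⟩
  topCoeff (x ∷ []) (suc d) k + topCoeff (+ 0 ∷ p) (suc d) k
    ≡⟨ cong (_+_ (topCoeff (x ∷ []) (suc d) k)) (topCoeff-0∷ p d k) ⟩
  topCoeff (x ∷ []) (suc d) k + topCoeff p d k
    ∎
  where
  open ≡-Reasoning
  x∷p≈ : (x ∷ p) ≈ₚ (x ∷ []) +ₚ (+ 0 ∷ p)
  x∷p≈ = ∷-cong (≡-sym (ℤₚ.+-identityʳ x)) ≈ₚ-refl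

-- The top-coefficient sequence of the constant x, read at degree D, is x placed at position D.
⋆-constant : ∀ x {q d₂} → Deg≤ q d₂ → ∀ D k →
             (topCoeff (x ∷ []) D ⋆ topCoeff q d₂) k ≡ x * topCoeff q (D ℕ.+ d₂) k
⋆-constant x {q} {d₂} q≤d₂ zero k = begin
  x * topCoeff q d₂ k + ∑< k (λ a → topCoeff (x ∷ []) 0 (suc a) * topCoeff q d₂ (k ∸ suc a))
    ≡⟨ cong (_+_ (x * topCoeff q d₂ k)) (∑<-zero k λ a → ℤₚ.*-zeroˡ (topCoeff q d₂ (k ∸ suc a))) ⟩
  x * topCoeff q d₂ k + + 0
    ≡⟨ ℤₚ.+-identityʳ _ ⟩
  x * topCoeff q d₂ k
    ∎
  where open ≡-Reasoning
⋆-constant x {q} {d₂} q≤d₂ (suc D) zero = begin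
  + 0 * coeff q d₂ + + 0                  ≡⟨ ℤₚ.+-identityʳ _ ⟩
  + 0 * coeff q d₂                        ≡⟨ ℤₚ.*-zeroˡ (coeff q d₂) ⟩
  + 0                                     ≡⟨ ℤₚ.*-zeroʳ x ⟨
  x * + 0                                 ≡⟨ cong (x *_) (vanishes q≤d₂ _ (s≤s (ℕₚ.m≤n+m d₂ D))) ⟨
  x * coeff q (suc D ℕ.+ d₂)              ∎
  where open ≡-Reasoning
⋆-constant x {q} {d₂} q≤d₂ (suc D) (suc k) =
  trans (cong (_+ (topCoeff (x ∷ []) D ⋆ topCoeff q d₂) k) (ℤₚ.*-zeroˡ (topCoeff q d₂ (suc k))))
        (trans (ℤₚ.+-identityˡ ((topCoeff (x ∷ []) D ⋆ topCoeff q d₂) k)) (⋆-constant x q≤d₂ D k))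

topCoeff-*ₚ : ∀ {p q d₁ d₂} → Deg≤ p d₁ → Deg≤ q d₂ →
              ∀ k → topCoeff (p *ₚ q) (d₁ ℕ.+ d₂) k ≡ (topCoeff p d₁ ⋆ topCoeff q d₂) k
topCoeff-*ₚ {[]} {q} {d₁} {d₂} _ _ k = begin
  topCoeff [] (d₁ ℕ.+ d₂) k                   ≡⟨ topCoeff-[] (d₁ ℕ.+ d₂) k ⟩
  + 0                                         ≡⟨ ∑<-zero (suc k) zeroTerm ⟨
  (topCoeff [] d₁ ⋆ topCoeff q d₂) k          ∎
  where
  open ≡-Reasoning
  zeroTerm : ∀ a → topCoeff [] d₁ a * topCoeff q d₂ (k ∸ a) ≡ + 0
  zeroTerm a = trans (cong (_* topCoeff q d₂ (k ∸ a)) (topCoeff-[] d₁ a)) (ℤₚ.*-zeroˡ (topCoeff q d₂ (k ∸ a)))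
topCoeff-*ₚ {x ∷ p} {q} {zero} {d₂} x∷p≤0 q≤d₂ k = begin
  topCoeff ((x ∷ p) *ₚ q) d₂ k
    ≡⟨ topCoeff-cong x∷p*q≈x·q d₂ k ⟩
  topCoeff (x ·ₚ q) d₂ k
    ≡⟨ topCoeff-·ₚ x q d₂ k ⟩
  x * topCoeff q d₂ k
    ≡⟨ ⋆-constant x q≤d₂ 0 k ⟨
  (topCoeff (x ∷ []) 0 ⋆ topCoeff q d₂) k
    ≡⟨ ⋆-cong {v = topCoeff q d₂} (topCoeff-cong (≈ₚ-sym x∷p≈x) 0) (λ _ → refl) k ⟩
  (topCoeff (x ∷ p) 0 ⋆ topCoeff q d₂) k
    ∎
  where
  open ≡-Reasoning
  p≈[] : p ≈ₚ []
  p≈[] = Deg≤0-tail x∷p≤0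
  x∷p≈x : (x ∷ p) ≈ₚ (x ∷ [])
  x∷p≈x = ∷-cong refl p≈[]
  x∷p*q≈x·q : (x ∷ p) *ₚ q ≈ₚ x ·ₚ q
  x∷p*q≈x·q = ≈ₚ-trans (+ₚ-cong ≈ₚ-refl (0∷-≈[] (*ₚ-zeroˡ q p≈[]))) (+ₚ-identityʳ (x ·ₚ q))
topCoeff-*ₚ {x ∷ p} {q} {suc d} {d₂} x∷p≤1+d q≤d₂ k = begin
  topCoeff ((x ∷ p) *ₚ q) (suc d ℕ.+ d₂) k
    ≡⟨ topCoeff-+ₚ (x ·ₚ q) _ (suc d ℕ.+ d₂) k ⟩
  topCoeff (x ·ₚ q) (suc d ℕ.+ d₂) k + topCoeff (+ 0 ∷ p *ₚ q) (suc d ℕ.+ d₂) k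
    ≡⟨ cong₂ _+_ (topCoeff-·ₚ x q (suc d ℕ.+ d₂) k) (topCoeff-0∷ (p *ₚ q) (d ℕ.+ d₂) k) ⟩
  x * topCoeff q (suc d ℕ.+ d₂) k + topCoeff (p *ₚ q) (d ℕ.+ d₂) k
    ≡⟨ cong₂ _+_ (⋆-constant x q≤d₂ (suc d) k) (≡-sym (topCoeff-*ₚ (Deg≤-tail x∷p≤1+d) q≤d₂ k)) ⟨
  (topCoeff (x ∷ []) (suc d) ⋆ topCoeff q d₂) k + (topCoeff p d ⋆ topCoeff q d₂) k
    ≡⟨ ⋆-distribʳ (topCoeff (x ∷ []) (suc d)) (topCoeff p d) (topCoeff q d₂) k ⟨
  ((λ a → topCoeff (x ∷ []) (suc d) a + topCoeff p d a) ⋆ topCoeff q d₂) k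
    ≡⟨ ⋆-cong {v = topCoeff q d₂} (λ a → ≡-sym (topCoeff-∷ x p d a)) (λ _ → refl) k ⟩
  (topCoeff (x ∷ p) (suc d) ⋆ topCoeff q d₂) k
    ∎
  where open ≡-Reasoning

dropZeros-++ : ∀ ys zs → dropZeros ys ≢ [] → dropZeros (ys ++ zs) ≡ dropZeros ys ++ zs
dropZeros-++ []              zs ys≢[] = contradiction refl ys≢[]
dropZeros-++ (+ zero ∷ ys)   zs ys≢[] = dropZeros-++ ys zs ys≢[]
dropZeros-++ (+ suc _ ∷ ys)  zs _     = refl
dropZeros-++ (-[1+ _ ] ∷ ys) zs _     = refl

dropZeros-reverse-zero : ∀ xs zs → xs ≈ₚ [] → dropZeros (reverse xs ++ zs) ≡ dropZeros zs
dropZeros-reverse-zero []       zs _       = refl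
dropZeros-reverse-zero (x ∷ xs) zs x∷xs≈[]
  rewrite Listₚ.unfold-reverse x xs | Listₚ.++-assoc (reverse xs) (x ∷ []) zs | coeff-≡ x∷xs≈[] 0 =
  dropZeros-reverse-zero xs (+ 0 ∷ zs) (coeffwise (coeff-≡ x∷xs≈[] ∘ suc))

dropZeros-nonzero : ∀ x → x ≢ + 0 → dropZeros (x ∷ []) ≡ x ∷ []
dropZeros-nonzero (+ zero)   x≢0 = contradiction refl x≢0
dropZeros-nonzero (+ suc _)  _   = refl
dropZeros-nonzero -[1+ _ ]   _   = refl

length-dropZeros-reverse : ∀ p d → Deg≤ p d → coeff p d ≢ + 0 → length (dropZeros (reverse p)) ≡ suc d
length-dropZeros-reverse []       d       _   p₀≢0 = contradiction refl p₀≢0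
length-dropZeros-reverse (x ∷ xs) zero    x∷xs≤0 x≢0
  rewrite Listₚ.unfold-reverse x xs | dropZeros-reverse-zero xs (x ∷ []) (Deg≤0-tail x∷xs≤0)
        | dropZeros-nonzero x x≢0 = refl
length-dropZeros-reverse (x ∷ xs) (suc d) x∷xs≤1+d xs_d≢0 rewrite Listₚ.unfold-reverse x xs = begin
  length (dropZeros (reverse xs ++ x ∷ []))        ≡⟨ cong length (dropZeros-++ (reverse xs) (x ∷ []) nonempty) ⟩
  length (dropZeros (reverse xs) ++ x ∷ [])        ≡⟨ Listₚ.length-++ (dropZeros (reverse xs)) ⟩
  length (dropZeros (reverse xs)) ℕ.+ 1            ≡⟨ cong (ℕ._+ 1) lengthTail ⟩
  suc d ℕ.+ 1                                      ≡⟨ ℕₚ.+-comm (suc d) 1 ⟩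
  suc (suc d)                                      ∎
  where
  open ≡-Reasoning
  lengthTail : length (dropZeros (reverse xs)) ≡ suc d
  lengthTail = length-dropZeros-reverse xs d (Deg≤-tail x∷xs≤1+d) xs_d≢0
  nonempty : dropZeros (reverse xs) ≢ []
  nonempty empty = ℕₚ.0≢1+n (trans (≡-sym (cong length empty)) lengthTail)

degree-≡ : ∀ {p d} → Deg≤ p d → coeff p d ≢ + 0 → degree p ≡ d
degree-≡ {p} {d} p≤d p_d≢0 = cong (_∸ 1) (length-dropZeros-reverse p d p≤d p_d≢0)

cₖ-topCoeff : ∀ p {d} → degree p ≡ d → ∀ k → cₖ k p ≡ topCoeff p d k
cₖ-topCoeff p refl k = go (degree p) k
  where
  go : ∀ d k → (if k ≤ᵇ d then coeff p (d ∸ k) else + 0) ≡ topCoeff p d k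
  go d       zero          = refl
  go zero    (suc k)       = refl
  go (suc d) (suc zero)    = refl
  go (suc d) (suc (suc k)) = go d (suc k)

record MonicOfDegree (d : ℕ) (p : Poly) : Set where
  field
    deg≤    : Deg≤ p d
    leading : coeff p d ≡ + 1
open MonicOfDegree

cₖ-monic : ∀ {p d} → MonicOfDegree d p → ∀ k → cₖ k p ≡ topCoeff p d k
cₖ-monic {p} M = cₖ-topCoeff p (degree-≡ (deg≤ M) λ p_d≡0 → 1≢0 (trans (≡-sym (leading M)) p_d≡0))
  where
  1≢0 : + 1 ≢ + 0
  1≢0 ()

MonicOfDegree-cong : ∀ {p q d} → p ≈ₚ q → MonicOfDegree d p → MonicOfDegree d q
MonicOfDegree-cong {d = d} p≈q M = record
  { deg≤ = Deg≤-cong p≈q (deg≤ M) ; leading = trans (≡-sym (coeff-≡ p≈q d)) (leading M) }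

MonicOfDegree-*ₚ : ∀ {p q d₁ d₂} → MonicOfDegree d₁ p → MonicOfDegree d₂ q →
                   MonicOfDegree (d₁ ℕ.+ d₂) (p *ₚ q)
MonicOfDegree-*ₚ {p} {q} {d₁} {d₂} Mp Mq = record
  { deg≤    = Deg≤-*ₚ (deg≤ Mp) (deg≤ Mq)
  ; leading = begin
      coeff (p *ₚ q) (d₁ ℕ.+ d₂)          ≡⟨ topCoeff-*ₚ (deg≤ Mp) (deg≤ Mq) 0 ⟩
      coeff p d₁ * coeff q d₂ + + 0       ≡⟨ cong₂ (λ a b → a * b + + 0) (leading Mp) (leading Mq) ⟩
      + 1                                 ∎
  }
  where open ≡-Reasoning

-- Characteristic polynomials of hollow matrices

-- The shape of xI − A for a constant matrix A with zero diagonal.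
record XIMinusHollow {m} (M : Mat Poly m) : Set where
  field
    diagonal    : ∀ i → M i i ≈ₚ Xₚ
    offDiagonal : ∀ i j → i ≢ j → Deg≤ (M i j) 0
open XIMinusHollow

Deg≤-Xₚ : Deg≤ Xₚ 1
Deg≤-Xₚ = vanishingAbove λ { (suc (suc i)) _ → refl ; (suc zero) (s≤s ()) }

entry-Deg≤1 : ∀ {m} {M : Mat Poly m} → XIMinusHollow M → ∀ i j → Deg≤ (M i j) 1
entry-Deg≤1 H i j with i Fin.≟ j
... | yes refl = Deg≤-cong (≈ₚ-sym (diagonal H i)) Deg≤-Xₚ
... | no i≢j   = Deg≤-mono z≤n (offDiagonal H i j i≢j)

minor-XIMinusHollow : ∀ {m} {M : Mat Poly (suc m)} → XIMinusHollow M → XIMinusHollow (minor M zero)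
minor-XIMinusHollow H = record
  { diagonal    = λ i → diagonal H (suc i)
  ; offDiagonal = λ i j i≢j → offDiagonal H (suc i) (suc j) (i≢j ∘ suc-injective)
  }

1-δ : ∀ {m} → Fin m → Fin m → ℕ
1-δ zero    zero    = 0
1-δ zero    (suc r) = 1
1-δ (suc j) zero    = 1
1-δ (suc j) (suc r) = 1-δ j r

1-δ-cases : ∀ {m} (j r : Fin m) → r ≡ j ⊎ 1-δ j r ≡ 1
1-δ-cases zero    zero    = inj₁ refl
1-δ-cases zero    (suc r) = inj₂ refl
1-δ-cases (suc j) zero    = inj₂ refl
1-δ-cases (suc j) (suc r) with 1-δ-cases j r
... | inj₁ r≡j = inj₁ (cong suc r≡j)
... | inj₂ δ≡1 = inj₂ δ≡1

sumℕ-const1 : ∀ m → sumℕ m (λ _ → 1) ≡ m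
sumℕ-const1 zero    = refl
sumℕ-const1 (suc m) = cong suc (sumℕ-const1 m)

sumℕ-1-δ : ∀ m (j : Fin (suc m)) → sumℕ (suc m) (1-δ j) ≡ m
sumℕ-1-δ m       zero    = sumℕ-const1 m
sumℕ-1-δ (suc m) (suc j) = cong suc (sumℕ-1-δ m j)

-- Deleting column suc j from the rows below the first removes the diagonal entry of row j only.
minor-row-Deg≤ : ∀ {m} {M : Mat Poly (suc m)} → XIMinusHollow M →
                 ∀ j r c → Deg≤ (minor M (suc j) r c) (1-δ j r)
minor-row-Deg≤ H j r c with 1-δ-cases j r
... | inj₁ refl = Deg≤-mono z≤n
      (offDiagonal H (suc r) (punchIn (suc r) c) (punchInᵢ≢i (suc r) c ∘ ≡-sym))
... | inj₂ δ≡1 rewrite δ≡1 = entry-Deg≤1 H (suc r) (punchIn (suc j) c)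

detₚ-Deg≤ : ∀ {m} {M : Mat Poly m} → XIMinusHollow M → Deg≤ (detₚ m M) m
detₚ-Deg≤ {m} H = subst (Deg≤ _) (sumℕ-const1 m) (Deg≤-detₚ m (λ _ → 1) (entry-Deg≤1 H))

laplaceTerm-suc-Deg≤ : ∀ {m} {M : Mat Poly (suc (suc m))} → XIMinusHollow M →
                       ∀ j → Deg≤ (laplaceTerm M (suc j)) m
laplaceTerm-suc-Deg≤ {m} H j = Deg≤-signₚ (toℕ (suc j)) (Deg≤-*ₚ {d₁ = 0}
  (offDiagonal H zero (suc j) (λ ()))
  (subst (Deg≤ _) (sumℕ-1-δ m j) (Deg≤-detₚ (suc m) (1-δ j) (minor-row-Deg≤ H j))))

coeff-Xₚ*ₚ-zero : ∀ p → coeff (Xₚ *ₚ p) 0 ≡ + 0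
coeff-Xₚ*ₚ-zero p = trans (coeff-+ₚ ((+ 0) ·ₚ p) _ 0) (cong (_+ + 0) (coeff-≡ (·ₚ-zeroˡ p) 0))

coeff-Xₚ*ₚ-suc : ∀ p i → coeff (Xₚ *ₚ p) (suc i) ≡ coeff p i
coeff-Xₚ*ₚ-suc p i = coeff-≡ (≈ₚ-trans (0∷-*ₚ (constₚ (+ 1)) p) (∷-cong refl (*ₚ-identityˡ p))) (suc i)

-- Every other Laplace term loses the x of a diagonal entry, so only the first reaches degree m.
laplaceTail-vanishes : ∀ {m} {M : Mat Poly (suc m)} → XIMinusHollow M →
                       ∀ i → m ≤ i → coeff (sumₚ m (laplaceTerm M ∘ suc)) i ≡ + 0
laplaceTail-vanishes {zero}  H i _   = refl
laplaceTail-vanishes {suc m} H i m<i = vanishes (Deg≤-sumₚ (suc m) (laplaceTerm-suc-Deg≤ H)) i m<i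

coeff-detₚ-high : ∀ {m} {M : Mat Poly (suc m)} → XIMinusHollow M →
                  ∀ i → m ≤ i → coeff (detₚ (suc m) M) i ≡ coeff (Xₚ *ₚ detₚ m (minor M zero)) i
coeff-detₚ-high {m} {M} H i m≤i = begin
  coeff (laplaceTerm M zero +ₚ tail) i
    ≡⟨ coeff-+ₚ (laplaceTerm M zero) tail i ⟩
  coeff (laplaceTerm M zero) i + coeff tail i
    ≡⟨ cong₂ _+_ (coeff-≡ firstTerm i) (laplaceTail-vanishes H i m≤i) ⟩
  coeff (Xₚ *ₚ detₚ m (minor M zero)) i + + 0
    ≡⟨ ℤₚ.+-identityʳ _ ⟩
  coeff (Xₚ *ₚ detₚ m (minor M zero)) i
    ∎
  where
  open ≡-Reasoning
  tail : Poly
  tail = sumₚ m (laplaceTerm M ∘ suc)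
  firstTerm : laplaceTerm M zero ≈ₚ Xₚ *ₚ detₚ m (minor M zero)
  firstTerm = *ₚ-congˡ _ (diagonal H zero)

coeff-detₚ-leading : ∀ m {M : Mat Poly m} → XIMinusHollow M → coeff (detₚ m M) m ≡ + 1
coeff-detₚ-leading zero    H = refl
coeff-detₚ-leading (suc m) {M} H = begin
  coeff (detₚ (suc m) M) (suc m)               ≡⟨ coeff-detₚ-high H (suc m) (ℕₚ.n≤1+n m) ⟩
  coeff (Xₚ *ₚ detₚ m (minor M zero)) (suc m)  ≡⟨ coeff-Xₚ*ₚ-suc (detₚ m (minor M zero)) m ⟩
  coeff (detₚ m (minor M zero)) m              ≡⟨ coeff-detₚ-leading m (minor-XIMinusHollow H) ⟩
  + 1                                          ∎
  where open ≡-Reasoning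

-- The coefficient of x^(m-1) is minus the trace, which vanishes on a hollow matrix.
coeff-detₚ-subleading : ∀ m {M : Mat Poly m} → XIMinusHollow M → topCoeff (detₚ m M) m 1 ≡ + 0
coeff-detₚ-subleading zero          H = refl
coeff-detₚ-subleading (suc zero)    {M} H =
  trans (coeff-detₚ-high H 0 z≤n) (coeff-Xₚ*ₚ-zero (detₚ 0 (minor M zero)))
coeff-detₚ-subleading (suc (suc m)) {M} H =
  trans (coeff-detₚ-high H (suc m) ℕₚ.≤-refl)
        (trans (coeff-Xₚ*ₚ-suc (detₚ (suc m) (minor M zero)) m)
               (coeff-detₚ-subleading (suc m) (minor-XIMinusHollow H)))

-- The disjoint union 2Γ

≡ᵇ-refl : ∀ a → (a ℕ.≡ᵇ a) ≡ true
≡ᵇ-refl zero    = refl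
≡ᵇ-refl (suc a) = ≡ᵇ-refl a

≡ᵇ-≢ : ∀ {a b} → a ≢ b → (a ℕ.≡ᵇ b) ≡ false
≡ᵇ-≢ {zero}  {zero}  a≢b = contradiction refl a≢b
≡ᵇ-≢ {zero}  {suc b} _   = refl
≡ᵇ-≢ {suc a} {zero}  _   = refl
≡ᵇ-≢ {suc a} {suc b} a≢b = ≡ᵇ-≢ (a≢b ∘ cong suc)

+-≡ᵇ : ∀ m a b → (m ℕ.+ a ℕ.≡ᵇ m ℕ.+ b) ≡ (a ℕ.≡ᵇ b)
+-≡ᵇ zero    a b = refl
+-≡ᵇ (suc m) a b = +-≡ᵇ m a b

toℕ-↑ˡ≢↑ʳ : ∀ {m k} (i : Fin m) (j : Fin k) → toℕ (i ↑ˡ k) ≢ toℕ (m ↑ʳ j)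
toℕ-↑ˡ≢↑ʳ {m} {k} i j eq = ℕₚ.<-irrefl refl (begin-strict
  m                  ≤⟨ ℕₚ.m≤m+n m (toℕ j) ⟩
  m ℕ.+ toℕ j        ≡⟨ toℕ-↑ʳ m j ⟨
  toℕ (m ↑ʳ j)       ≡⟨ eq ⟨
  toℕ (i ↑ˡ k)       ≡⟨ toℕ-↑ˡ i k ⟩
  toℕ i              <⟨ toℕ<n i ⟩
  m                  ∎)
  where open ℕₚ.≤-Reasoning

module _ {m k : ℕ} where

  ≡ᵇ-↑ˡ↑ˡ : ∀ (i j : Fin m) → (toℕ (i ↑ˡ k) ℕ.≡ᵇ toℕ (j ↑ˡ k)) ≡ (toℕ i ℕ.≡ᵇ toℕ j)
  ≡ᵇ-↑ˡ↑ˡ i j rewrite toℕ-↑ˡ i k | toℕ-↑ˡ j k = refl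

  ≡ᵇ-↑ʳ↑ʳ : ∀ (i j : Fin k) → (toℕ (m ↑ʳ i) ℕ.≡ᵇ toℕ (m ↑ʳ j)) ≡ (toℕ i ℕ.≡ᵇ toℕ j)
  ≡ᵇ-↑ʳ↑ʳ i j rewrite toℕ-↑ʳ m i | toℕ-↑ʳ m j = +-≡ᵇ m (toℕ i) (toℕ j)

  ≡ᵇ-↑ˡ↑ʳ : ∀ (i : Fin m) (j : Fin k) → (toℕ (i ↑ˡ k) ℕ.≡ᵇ toℕ (m ↑ʳ j)) ≡ false
  ≡ᵇ-↑ˡ↑ʳ i j = ≡ᵇ-≢ (toℕ-↑ˡ≢↑ʳ i j)

  ≡ᵇ-↑ʳ↑ˡ : ∀ (i : Fin k) (j : Fin m) → (toℕ (m ↑ʳ i) ℕ.≡ᵇ toℕ (j ↑ˡ k)) ≡ false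
  ≡ᵇ-↑ʳ↑ˡ i j = ≡ᵇ-≢ (toℕ-↑ˡ≢↑ʳ j i ∘ ≡-sym)

module _ {N : ℕ} (a : Fin N → Fin N → Bool) where

  adj2-↑ˡ↑ˡ : ∀ i j → adj2 N a (i ↑ˡ N) (j ↑ˡ N) ≡ a i j
  adj2-↑ˡ↑ˡ i j rewrite splitAt-↑ˡ N i N | splitAt-↑ˡ N j N = refl

  adj2-↑ʳ↑ʳ : ∀ i j → adj2 N a (N ↑ʳ i) (N ↑ʳ j) ≡ a i j
  adj2-↑ʳ↑ʳ i j rewrite splitAt-↑ʳ N N i | splitAt-↑ʳ N N j = refl

  adj2-↑ˡ↑ʳ : ∀ i j → adj2 N a (i ↑ˡ N) (N ↑ʳ j) ≡ false
  adj2-↑ˡ↑ʳ i j rewrite splitAt-↑ˡ N i N | splitAt-↑ʳ N N j = refl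

  adj2-↑ʳ↑ˡ : ∀ i j → adj2 N a (N ↑ʳ i) (j ↑ˡ N) ≡ false
  adj2-↑ʳ↑ˡ i j rewrite splitAt-↑ʳ N N i | splitAt-↑ˡ N j N = refl

charEntry : Bool → Bool → Poly
charEntry onDiagonal a = (if onDiagonal then Xₚ else []) +ₚ negₚ (constₚ (b2z a))

-- charPoly G is definitionally detₚ (n G) (charMatrix G).
charMatrix : (G : Graph) → Mat Poly (n G)
charMatrix G i j = charEntry (toℕ i ℕ.≡ᵇ toℕ j) (adj G i j)

charMatrix-XIMinusHollow : ∀ G → XIMinusHollow (charMatrix G)
charMatrix-XIMinusHollow G = record { diagonal = diagonal′ ; offDiagonal = offDiagonal′ }
  where
  diagonal′ : ∀ i → charMatrix G i i ≈ₚ Xₚ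
  diagonal′ i rewrite ≡ᵇ-refl (toℕ i) | irr G i = ≈ₚ-refl
  constant : ∀ a → Deg≤ (charEntry false a) 0
  constant true  = vanishingAbove λ { (suc i) _ → refl }
  constant false = vanishingAbove λ { (suc i) _ → refl }
  offDiagonal′ : ∀ i j → i ≢ j → Deg≤ (charMatrix G i j) 0
  offDiagonal′ i j i≢j rewrite ≡ᵇ-≢ (i≢j ∘ toℕ-injective) = constant (adj G i j)

charMatrix-double : ∀ G → BlockLowerTriangular (charMatrix (double G)) (charMatrix G) (charMatrix G)
charMatrix-double G = record
  { upperLeft  = λ i j → ≈ₚ-reflexive (cong₂ charEntry (≡ᵇ-↑ˡ↑ˡ i j) (adj2-↑ˡ↑ˡ (adj G) i j))
  ; lowerRight = λ i j → ≈ₚ-reflexive (cong₂ charEntry (≡ᵇ-↑ʳ↑ʳ {m = n G} i j) (adj2-↑ʳ↑ʳ (adj G) i j))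
  ; upperRight = λ i j → ≈ₚ-trans (≈ₚ-reflexive (cong₂ charEntry (≡ᵇ-↑ˡ↑ʳ i j) (adj2-↑ˡ↑ʳ (adj G) i j)))
                                   (0∷-≈[] ≈ₚ-refl)
  }

charPoly-double : ∀ G → charPoly (double G) ≈ₚ charPoly G *ₚ charPoly G
charPoly-double G = detₚ-blockLowerTriangular (n G) (n G) (charMatrix-double G)

charPoly-monic : ∀ G → MonicOfDegree (n G) (charPoly G)
charPoly-monic G = record
  { deg≤    = detₚ-Deg≤ (charMatrix-XIMinusHollow G)
  ; leading = coeff-detₚ-leading (n G) (charMatrix-XIMinusHollow G)
  }

cₖ0-charPoly : ∀ G → cₖ 0 (charPoly G) ≡ + 1
cₖ0-charPoly G = trans (cₖ-monic (charPoly-monic G) 0) (leading (charPoly-monic G))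

cₖ1-charPoly : ∀ G → cₖ 1 (charPoly G) ≡ + 0
cₖ1-charPoly G = trans (cₖ-monic (charPoly-monic G) 1)
                       (coeff-detₚ-subleading (n G) (charMatrix-XIMinusHollow G))

cₖ-charPoly-double : ∀ G k →
  cₖ k (charPoly (double G)) ≡ ((λ i → cₖ i (charPoly G)) ⋆ (λ i → cₖ i (charPoly G))) k
cₖ-charPoly-double G k = begin
  cₖ k Q                                    ≡⟨ cₖ-monic (MonicOfDegree-cong (≈ₚ-sym Q≈P*P) P*P-monic) k ⟩
  topCoeff Q (N ℕ.+ N) k                    ≡⟨ topCoeff-cong Q≈P*P (N ℕ.+ N) k ⟩
  topCoeff (P *ₚ P) (N ℕ.+ N) k             ≡⟨ topCoeff-*ₚ (deg≤ P-monic) (deg≤ P-monic) k ⟩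
  (topCoeff P N ⋆ topCoeff P N) k           ≡⟨ ⋆-cong {u = λ i → cₖ i P} {v = λ i → cₖ i P} cₖP≡ cₖP≡ k ⟨
  ((λ i → cₖ i P) ⋆ (λ i → cₖ i P)) k       ∎
  where
  open ≡-Reasoning
  N = n G
  P = charPoly G
  Q = charPoly (double G)
  P-monic : MonicOfDegree N P
  P-monic = charPoly-monic G
  P*P-monic : MonicOfDegree (N ℕ.+ N) (P *ₚ P)
  P*P-monic = MonicOfDegree-*ₚ P-monic P-monic
  Q≈P*P : Q ≈ₚ P *ₚ P
  Q≈P*P = charPoly-double G
  cₖP≡ : ∀ i → cₖ i P ≡ topCoeff P N i
  cₖP≡ = cₖ-monic P-monic

sumℕ-cong : ∀ m {f g : Fin m → ℕ} → (∀ j → f j ≡ g j) → sumℕ m f ≡ sumℕ m g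
sumℕ-cong zero    f≡g = refl
sumℕ-cong (suc m) f≡g = cong₂ ℕ._+_ (f≡g zero) (sumℕ-cong m (f≡g ∘ suc))

sumℕ-zero : ∀ m {f : Fin m → ℕ} → (∀ j → f j ≡ 0) → sumℕ m f ≡ 0
sumℕ-zero m f≡0 = trans (sumℕ-cong m f≡0) (sumℕ-const0 m)
  where
  sumℕ-const0 : ∀ m → sumℕ m (λ _ → 0) ≡ 0
  sumℕ-const0 zero    = refl
  sumℕ-const0 (suc m) = sumℕ-const0 m

sumℕ-split : ∀ m k (f : Fin (m ℕ.+ k) → ℕ) →
             sumℕ (m ℕ.+ k) f ≡ sumℕ m (λ j → f (j ↑ˡ k)) ℕ.+ sumℕ k (λ j → f (m ↑ʳ j))
sumℕ-split zero    k f = refl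
sumℕ-split (suc m) k f =
  trans (cong (f zero ℕ.+_) (sumℕ-split m k (f ∘ suc))) (≡-sym (ℕₚ.+-assoc (f zero) _ _))

idMatℕ≡b2n : ∀ {m} (i j : Fin m) → idMatℕ i j ≡ b2n (toℕ i ℕ.≡ᵇ toℕ j)
idMatℕ≡b2n i j with toℕ i ℕ.≟ toℕ j
... | yes i≡j rewrite i≡j = cong b2n (≡-sym (≡ᵇ-refl (toℕ j)))
... | no  i≢j = cong b2n (≡-sym (≡ᵇ-≢ i≢j))

record BlockDiagonal {m k} (B : Mat ℕ (m ℕ.+ k)) (P : Mat ℕ m) (Q : Mat ℕ k) : Set where
  field
    upperLeft  : ∀ i j → B (i ↑ˡ k) (j ↑ˡ k) ≡ P i j
    lowerRight : ∀ i j → B (m ↑ʳ i) (m ↑ʳ j) ≡ Q i j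
    upperRight : ∀ i j → B (i ↑ˡ k) (m ↑ʳ j) ≡ 0
    lowerLeft  : ∀ i j → B (m ↑ʳ i) (j ↑ˡ k) ≡ 0
open BlockDiagonal

idMatℕ-blockDiagonal : ∀ {m k} → BlockDiagonal {m} {k} idMatℕ idMatℕ idMatℕ
idMatℕ-blockDiagonal {m} {k} = record
  { upperLeft  = λ i j → trans (idMatℕ≡b2n _ _) (trans (cong b2n (≡ᵇ-↑ˡ↑ˡ i j)) (≡-sym (idMatℕ≡b2n i j)))
  ; lowerRight = λ i j → trans (idMatℕ≡b2n _ _) (trans (cong b2n (≡ᵇ-↑ʳ↑ʳ {m} i j)) (≡-sym (idMatℕ≡b2n i j)))
  ; upperRight = λ i j → trans (idMatℕ≡b2n _ _) (cong b2n (≡ᵇ-↑ˡ↑ʳ i j))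
  ; lowerLeft  = λ i j → trans (idMatℕ≡b2n _ _) (cong b2n (≡ᵇ-↑ʳ↑ˡ i j))
  }

matMulℕ-blockDiagonal : ∀ {m k} {B B′ : Mat ℕ (m ℕ.+ k)} {P P′ : Mat ℕ m} {Q Q′ : Mat ℕ k} →
  BlockDiagonal B P Q → BlockDiagonal B′ P′ Q′ →
  BlockDiagonal (matMulℕ B B′) (matMulℕ P P′) (matMulℕ Q Q′)
matMulℕ-blockDiagonal {m} {k} {B} {B′} {P} {P′} {Q} {Q′} D D′ = record
  { upperLeft  = λ i j → trans (split (i ↑ˡ k) (j ↑ˡ k))
      (trans (cong₂ ℕ._+_ (sumℕ-cong m λ l → cong₂ ℕ._*_ (upperLeft D i l) (upperLeft D′ l j))
                          (sumℕ-zero k λ l → cong (ℕ._* _) (upperRight D i l)))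
             (ℕₚ.+-identityʳ _))
  ; lowerRight = λ i j → trans (split (m ↑ʳ i) (m ↑ʳ j))
      (cong₂ ℕ._+_ (sumℕ-zero m λ l → cong (ℕ._* _) (lowerLeft D i l))
                   (sumℕ-cong k λ l → cong₂ ℕ._*_ (lowerRight D i l) (lowerRight D′ l j)))
  ; upperRight = λ i j → trans (split (i ↑ˡ k) (m ↑ʳ j))
      (cong₂ ℕ._+_ (sumℕ-zero m λ l → trans (cong (B (i ↑ˡ k) (l ↑ˡ k) ℕ.*_) (upperRight D′ l j))
                                            (ℕₚ.*-zeroʳ (B (i ↑ˡ k) (l ↑ˡ k))))
                   (sumℕ-zero k λ l → cong (ℕ._* _) (upperRight D i l)))
  ; lowerLeft  = λ i j → trans (split (m ↑ʳ i) (j ↑ˡ k))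
      (cong₂ ℕ._+_ (sumℕ-zero m λ l → cong (ℕ._* _) (lowerLeft D i l))
                   (sumℕ-zero k λ l → trans (cong (B (m ↑ʳ i) (m ↑ʳ l) ℕ.*_) (lowerLeft D′ l j))
                                            (ℕₚ.*-zeroʳ (B (m ↑ʳ i) (m ↑ʳ l)))))
  }
  where
  split : ∀ x y → matMulℕ B B′ x y ≡ sumℕ m (λ l → B x (l ↑ˡ k) ℕ.* B′ (l ↑ˡ k) y)
                                     ℕ.+ sumℕ k (λ l → B x (m ↑ʳ l) ℕ.* B′ (m ↑ʳ l) y)
  split x y = sumℕ-split m k (λ l → B x l ℕ.* B′ l y)

matPowℕ-blockDiagonal : ∀ {m k} {B : Mat ℕ (m ℕ.+ k)} {P : Mat ℕ m} {Q : Mat ℕ k} →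
  BlockDiagonal B P Q → ∀ r → BlockDiagonal (matPowℕ B r) (matPowℕ P r) (matPowℕ Q r)
matPowℕ-blockDiagonal D zero    = idMatℕ-blockDiagonal
matPowℕ-blockDiagonal D (suc r) = matMulℕ-blockDiagonal D (matPowℕ-blockDiagonal D r)

entrySum : ∀ {m} → Mat ℕ m → ℕ
entrySum {m} M = sumℕ m (λ i → sumℕ m (λ j → M i j))

entrySum-blockDiagonal : ∀ {m k} {B : Mat ℕ (m ℕ.+ k)} {P : Mat ℕ m} {Q : Mat ℕ k} →
  BlockDiagonal B P Q → entrySum B ≡ entrySum P ℕ.+ entrySum Q
entrySum-blockDiagonal {m} {k} {B} D = trans (sumℕ-split m k (λ x → sumℕ (m ℕ.+ k) (B x)))
  (cong₂ ℕ._+_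
    (sumℕ-cong m λ i → trans (sumℕ-split m k (B (i ↑ˡ k)))
      (trans (cong₂ ℕ._+_ (sumℕ-cong m (upperLeft D i)) (sumℕ-zero k (upperRight D i))) (ℕₚ.+-identityʳ _)))
    (sumℕ-cong k λ i → trans (sumℕ-split m k (B (m ↑ʳ i)))
      (cong₂ ℕ._+_ (sumℕ-zero m (lowerLeft D i)) (sumℕ-cong k (lowerRight D i)))))

adjacency-double : ∀ G → BlockDiagonal (Aℕ (double G)) (Aℕ G) (Aℕ G)
adjacency-double G = record
  { upperLeft  = λ i j → cong b2n (adj2-↑ˡ↑ˡ (adj G) i j)
  ; lowerRight = λ i j → cong b2n (adj2-↑ʳ↑ʳ (adj G) i j)
  ; upperRight = λ i j → cong b2n (adj2-↑ˡ↑ʳ (adj G) i j)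
  ; lowerLeft  = λ i j → cong b2n (adj2-↑ʳ↑ˡ (adj G) i j)
  }

walkSum-double : ∀ G k → walkSum (double G) k ≡ walkSum G k ℕ.+ walkSum G k
walkSum-double G k = entrySum-blockDiagonal (matPowℕ-blockDiagonal (adjacency-double G) k)

2^[e∸2]∣-double : ∀ e {w} → 2 ℕ.^ (e ∸ 2) ℕᵈ.∣ w → 2 ℕ.^ (suc e ∸ 2) ℕᵈ.∣ w ℕ.+ w
2^[e∸2]∣-double zero          _ = ℕᵈ.1∣ _
2^[e∸2]∣-double (suc zero)    _ = ℕᵈ.1∣ _
2^[e∸2]∣-double (suc (suc e)) {w} 2^e∣w =
  subst (2 ℕ.^ suc e ℕᵈ.∣_) (cong (w ℕ.+_) (ℕₚ.+-identityʳ w)) (ℕᵈ.*-monoʳ-∣ 2 2^e∣w)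

-- Powers of two dividing the coefficients of P²

m≡1+[m∸1] : ∀ {m} → 0 < m → m ≡ suc (m ∸ 1)
m≡1+[m∸1] {suc m} _ = refl

∣0 : ∀ {m} → m ∣ + 0
∣0 = divides (+ 0) refl

∑<-∣ : ∀ {d} m {f : ℕ → ℤ} → (∀ a → a < m → d ∣ f a) → d ∣ ∑< m f
∑<-∣ zero    d∣f = ∣0
∑<-∣ (suc m) d∣f = ∣m∣n⇒∣m+n (d∣f 0 (s≤s z≤n)) (∑<-∣ m λ a a<m → d∣f (suc a) (s≤s a<m))

pow2-suc : ∀ t → pow2 (suc t) ≡ pow2 t + pow2 t
pow2-suc t = cong (λ y → + (2 ℕ.^ t ℕ.+ y)) (ℕₚ.+-identityʳ (2 ℕ.^ t))

pow2-∣ : ∀ {a b} → a ≤ b → pow2 a ∣ pow2 b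
pow2-∣ {a} a≤b with ℕₚ.m≤n⇒∃[o]m+o≡n a≤b
... | c , refl = divides (pow2 c) (begin
  + (2 ℕ.^ (a ℕ.+ c))               ≡⟨ cong +_ (ℕₚ.^-distribˡ-+-* 2 a c) ⟩
  + (2 ℕ.^ a ℕ.* 2 ℕ.^ c)           ≡⟨ ℤₚ.pos-* (2 ℕ.^ a) (2 ℕ.^ c) ⟩
  pow2 a * pow2 c                   ≡⟨ ℤₚ.*-comm (pow2 a) (pow2 c) ⟩
  pow2 c * pow2 a                   ∎)
  where open ≡-Reasoning

pow2-∣-weaken : ∀ {a b x} → a ≤ b → pow2 b ∣ x → pow2 a ∣ x
pow2-∣-weaken a≤b = ∣-trans (pow2-∣ a≤b)

pow2-∣-double : ∀ t {x} → pow2 t ∣ x → pow2 (suc t) ∣ x + x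
pow2-∣-double t (divides q refl) =
  divides q (trans (≡-sym (ℤₚ.*-distribˡ-+ q (pow2 t) (pow2 t))) (cong (q *_) (≡-sym (pow2-suc t))))

record LiftedSequence (e f : ℕ) (c : ℕ → ℤ) : Set where
  field
    coeffs : ∀ k → 1 ≤ k → k < e → k ≢ f → c k ≡ + 0 [mod pow2 (e ∸ k) ]
    coeffF : c f ≡ pow2 (e ∸ f ∸ 1) [mod pow2 (e ∸ f) ]

LiftedSequence-cong : ∀ {e f c c′} → (∀ k → c k ≡ c′ k) → LiftedSequence e f c → LiftedSequence e f c′
LiftedSequence-cong {e} {f} c≡c′ L = record
  { coeffs = λ k 1≤k k<e k≢f →
      subst (_≡ + 0 [mod pow2 (e ∸ k) ]) (c≡c′ k) (LiftedSequence.coeffs L k 1≤k k<e k≢f)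
  ; coeffF = subst (_≡ pow2 (e ∸ f ∸ 1) [mod pow2 (e ∸ f) ]) (c≡c′ f) (LiftedSequence.coeffF L)
  }

crossTerms : (ℕ → ℤ) → ℕ → ℤ
crossTerms c k = ∑< k (λ a → c (suc a) * c (k ∸ a))

⋆-self-suc : ∀ c → c 0 ≡ + 1 → ∀ k → (c ⋆ c) (suc k) ≡ (c (suc k) + c (suc k)) + crossTerms c k
⋆-self-suc c c₀≡1 k = begin
  c 0 * c (suc k) + ∑< (suc k) (λ a → c (suc a) * c (k ∸ a))
    ≡⟨ cong (_+_ (c 0 * c (suc k))) (∑<-last k (λ a → c (suc a) * c (k ∸ a))) ⟩
  c 0 * c (suc k) + (crossTerms c k + c (suc k) * c (k ∸ k))
    ≡⟨ cong (λ z → c 0 * c (suc k) + (crossTerms c k + c (suc k) * c z)) (ℕₚ.n∸n≡0 k) ⟩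
  c 0 * c (suc k) + (crossTerms c k + c (suc k) * c 0)
    ≡⟨ cong (λ z → z * c (suc k) + (crossTerms c k + c (suc k) * z)) c₀≡1 ⟩
  + 1 * c (suc k) + (crossTerms c k + c (suc k) * + 1)
    ≡⟨ rearrange (c (suc k)) (crossTerms c k) ⟩
  (c (suc k) + c (suc k)) + crossTerms c k
    ∎
  where
  open ≡-Reasoning
  rearrange : ∀ x m → + 1 * x + (m + x * + 1) ≡ (x + x) + m
  rearrange = solve-∀

module Lifted {e f : ℕ} {c : ℕ → ℤ} (c₀≡1 : c 0 ≡ + 1) (c₁≡0 : c 1 ≡ + 0)
              (L : LiftedSequence e f c) where

  coeffF-∣ : pow2 (e ∸ f) ∣ c f - pow2 (e ∸ f ∸ 1)
  coeffF-∣ = ∣ᵤ⇒∣ (LiftedSequence.coeffF L)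

  coeff-∣ : ∀ k → 1 ≤ k → k ≤ e → k ≢ f → pow2 (e ∸ k) ∣ c k - + 0
  coeff-∣ k 1≤k k≤e k≢f with ℕₚ.m≤n⇒m<n∨m≡n k≤e
  ... | inj₁ k<e  = ∣ᵤ⇒∣ (LiftedSequence.coeffs L k 1≤k k<e k≢f)
  ... | inj₂ refl rewrite ℕₚ.n∸n≡0 k = divides (c k - + 0) (≡-sym (ℤₚ.*-identityʳ (c k - + 0)))

  -- At i = f the hypothesis only yields 2^(e-f-1), so this is the bound available for every i.
  weak-∣ : ∀ i → 1 ≤ i → i < e → pow2 (e ∸ i ∸ 1) ∣ c i
  weak-∣ i 1≤i i<e with i ℕ.≟ f
  ... | no i≢f   = subst (_ ∣_) (ℤₚ.+-identityʳ (c i))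
                     (pow2-∣-weaken (ℕₚ.m∸n≤m (e ∸ i) 1) (coeff-∣ i 1≤i (ℕₚ.<⇒≤ i<e) i≢f))
  ... | yes refl = ∣m+n∣n⇒∣m (pow2-∣-weaken (ℕₚ.m∸n≤m (e ∸ i) 1) coeffF-∣) (∣m⇒∣-m ∣-refl)

  -- Since b ≥ 2 the bound on c (suc a) alone suffices, and c 1 = 0 disposes of b = 1.
  crossTerm-∣ : ∀ a b → suc (a ℕ.+ b) < e → pow2 (e ∸ suc (a ℕ.+ b)) ∣ c (suc a) * c (suc b)
  crossTerm-∣ a zero    _ rewrite c₁≡0 = subst (_ ∣_) (≡-sym (ℤₚ.*-zeroʳ (c (suc a)))) ∣0
  crossTerm-∣ a (suc b) k<e =
    ∣m⇒∣m*n (c (suc (suc b))) (pow2-∣-weaken exponent (weak-∣ (suc a) (s≤s z≤n) 1+a<e))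
    where
    1+a<e : suc a < e
    1+a<e = ℕₚ.≤-<-trans (s≤s (ℕₚ.m≤m+n a (suc b))) k<e
    exponent : e ∸ suc (a ℕ.+ suc b) ≤ e ∸ suc a ∸ 1
    exponent = ℕₚ.≤-trans (ℕₚ.∸-monoʳ-≤ e (s≤s (ℕₚ.+-monoʳ-≤ a (s≤s z≤n))))
                          (ℕₚ.≤-reflexive (≡-sym (ℕₚ.∸-+-assoc e (suc a) 1)))

  crossTerms-∣ : ∀ k → k < e → pow2 (e ∸ k) ∣ crossTerms c k
  crossTerms-∣ k k<e = ∑<-∣ k term-∣
    where
    term-∣ : ∀ a → a < k → pow2 (e ∸ k) ∣ c (suc a) * c (k ∸ a)
    term-∣ a a<k with ℕₚ.m≤n⇒∃[o]m+o≡n a<k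
    ... | b , refl = subst (λ z → pow2 (e ∸ suc (a ℕ.+ b)) ∣ c (suc a) * c z)
                           (≡-sym (trans (ℕₚ.+-∸-assoc 1 (ℕₚ.m≤m+n a b)) (cong suc (ℕₚ.m+n∸m≡n a b))))
                           (crossTerm-∣ a b k<e)

  ⋆-self-∣ : ∀ k {t y} → k < e → e ∸ k ≡ suc t → pow2 t ∣ c (suc k) - y →
             pow2 (e ∸ k) ∣ (c ⋆ c) (suc k) - (y + y)
  ⋆-self-∣ k {t} {y} k<e e∸k≡1+t c≡y = subst (pow2 (e ∸ k) ∣_) shape
    (∣m∣n⇒∣m+n (subst (λ u → pow2 u ∣ (c (suc k) - y) + (c (suc k) - y)) (≡-sym e∸k≡1+t)
                      (pow2-∣-double t c≡y))
               (crossTerms-∣ k k<e))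
    where
    open ≡-Reasoning
    rearrange : ∀ x y X → ((x - y) + (x - y)) + X ≡ ((x + x) + X) - (y + y)
    rearrange = solve-∀
    shape : ((c (suc k) - y) + (c (suc k) - y)) + crossTerms c k ≡ (c ⋆ c) (suc k) - (y + y)
    shape = begin
      ((c (suc k) - y) + (c (suc k) - y)) + crossTerms c k  ≡⟨ rearrange (c (suc k)) y (crossTerms c k) ⟩
      ((c (suc k) + c (suc k)) + crossTerms c k) - (y + y)  ≡⟨ cong (_- (y + y)) (⋆-self-suc c c₀≡1 k) ⟨
      (c ⋆ c) (suc k) - (y + y)                             ∎

⋆-self-lifted : ∀ {e f c} → 0 < f → f < e → c 0 ≡ + 1 → c 1 ≡ + 0 →
                LiftedSequence e f c → LiftedSequence (suc e) f (c ⋆ c)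
⋆-self-lifted {e} {suc f′} {c} _ f<e c₀≡1 c₁≡0 L = record { coeffs = coeffs′ ; coeffF = coeffF′ }
  where
  open Lifted c₀≡1 c₁≡0 L
  coeffs′ : ∀ k → 1 ≤ k → k < suc e → k ≢ suc f′ → (c ⋆ c) k ≡ + 0 [mod pow2 (suc e ∸ k) ]
  coeffs′ (suc k) _ (s≤s k<e) k≢f =
    ∣⇒∣ᵤ (⋆-self-∣ k {y = + 0} k<e (ℕₚ.+-∸-assoc 1 k<e) (coeff-∣ (suc k) (s≤s z≤n) k<e k≢f))
  e∸f′≡1+[e∸f] : e ∸ f′ ≡ suc (e ∸ suc f′)
  e∸f′≡1+[e∸f] = ℕₚ.+-∸-assoc 1 (ℕₚ.<⇒≤ f<e)
  doubled : pow2 (e ∸ suc f′ ∸ 1) + pow2 (e ∸ suc f′ ∸ 1) ≡ pow2 (e ∸ f′ ∸ 1)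
  doubled = begin
    pow2 (e ∸ suc f′ ∸ 1) + pow2 (e ∸ suc f′ ∸ 1) ≡⟨ pow2-suc (e ∸ suc f′ ∸ 1) ⟨
    pow2 (suc (e ∸ suc f′ ∸ 1))                   ≡⟨ cong pow2 (m≡1+[m∸1] (ℕₚ.m<n⇒0<n∸m f<e)) ⟨
    pow2 (e ∸ suc f′)                             ≡⟨ cong (pow2 ∘ (_∸ 1)) e∸f′≡1+[e∸f] ⟨
    pow2 (e ∸ f′ ∸ 1)                             ∎
    where open ≡-Reasoning
  coeffF′ : (c ⋆ c) (suc f′) ≡ pow2 (e ∸ f′ ∸ 1) [mod pow2 (e ∸ f′) ]
  coeffF′ = ∣⇒∣ᵤ (subst (λ z → pow2 (e ∸ f′) ∣ (c ⋆ c) (suc f′) - z) doubled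
                        (⋆-self-∣ f′ (ℕₚ.<-trans (ℕₚ.n<1+n f′) f<e) e∸f′≡1+[e∸f] coeffF-∣))

lemma4p4 : (e f : ℕ) (G : Graph) →
    LiftTypeI e f G → LiftTypeI (suc e) f (double G)
lemma4p4 e f G L = record
  { e-pos  = ℕₚ.m<n⇒m<1+n e-pos
  ; f-pos  = f-pos
  ; f<e    = ℕₚ.m<n⇒m<1+n f<e
  ; walks  = λ k → subst (2 ℕ.^ (suc e ∸ 2) ℕᵈ.∣_) (≡-sym (walkSum-double G k)) (2^[e∸2]∣-double e (walks k))
  ; coeffs = LiftedSequence.coeffs lifted²
  ; coeffF = LiftedSequence.coeffF lifted²
  }
  where
  open LiftTypeI L
  lifted : LiftedSequence e f (λ k → cₖ k (charPoly G))
  lifted = record { coeffs = coeffs ; coeffF = coeffF }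
  lifted² : LiftedSequence (suc e) f (λ k → cₖ k (charPoly (double G)))
  lifted² = LiftedSequence-cong (≡-sym ∘ cₖ-charPoly-double G)
              (⋆-self-lifted f-pos f<e (cₖ0-charPoly G) (cₖ1-charPoly G) lifted)
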